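{- Let $B_\infty$ be the infinite braid group, with generators $\sigma_i$ ($i\ge 1$) subject to $\sigma_i\sigma_j=\sigma_j\sigma_i$ when $|i-j|>1$ and $\sigma_i\sigma_j\sigma_i=\sigma_j\sigma_i\sigma_j$ when $|i-j|=1$. Let ${\cal F}_X$ be the free group on generators $x_0,x_1,x_2,\ldots$, with the right action of $B_\infty$ by automorphisms given on generators by $(x_i)\sigma_i^{\pm1}=x_{i\pm1}x_i^{ -1}x_{i\mp1}$ and $(x_j)\sigma_i^{\pm1}=x_j$ for $j\ne i$. Let $f\in{\cal F}_X$ be such that its reduced form begins with $x_m$, let $k\ge1$ and $\epsilon\in\{+1,-1\}$. Then the reduced form of $(f)\sigma_k^{\epsilon}$ begins with this same $x_m$, except in the following two cases: (1) $k=m+\epsilon$ and the reduced form of $f$ begins with $x_m x_{m+\epsilon}^{ -1}$; in this case the reduced form of $(f)\sigma_{m+\epsilon}^{\epsilon}$ begins with $x_{m+\epsilon}$; (2) $k=m$; in this case the reduced form of $(f)\sigma_m^{\epsilon}$ begins with $x_{m+\epsilon}x_m^{ -1}$.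
   Context: This action is obtained as follows: let ${\cal F}_G$ be the free group on $g_0,g_1,\ldots$ with the right $B_\infty$-action $(g_i)\sigma_i=g_ig_{i+1}g_i^{ -1}$, $(g_{i+1})\sigma_i=g_i$, $(g_j)\sigma_i=g_j$ ($j\ne i,i+1$); let $\phi:{\cal F}_X\to{\cal F}_G$ be the isomorphism with $(x_i)\phi=g_0g_1\cdots g_i$; and set $(f)p=(f)\phi p\phi^{ -1}$. On generators this yields the formulas stated in the claim. $(f)p$ denotes the image of $f$ under $p$, with $(f)(pq)=((f)p)q$. "Reduced form" means the freely reduced word in the $x_j^{\pm1}$, and "begins with" refers to its initial letters. -}

module Defs where

open import Data.Nat using (ℕ; zero; suc; _∸_)
open import Data.Bool using (Bool; true; false; not)
open import Data.List using (List; []; _∷_; _++_; foldr; concatMap)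
open import Data.Product using (_×_; _,_; ∃)
open import Data.Unit using (⊤)
open import Relation.Binary.PropositionalEquality using (_≡_)
open import Relation.Nullary using (¬_; yes; no)
import Data.Nat as ℕ
import Data.Bool as 𝔹

-- A letter of the free group F_X on x_0, x_1, ... :
-- (i , true) is x_i and (i , false) is x_i^{-1}.
Letter : Set
Letter = ℕ × Bool

Word : Set
Word = List Letter

x : ℕ → Letter
x i = (i , true)

x⁻¹ : ℕ → Letter
x⁻¹ i = (i , false)

Inverse : Letter → Letter → Set
Inverse (i , a) (j , b) = (i ≡ j) × (a ≡ not b)

IsReduced : Word → Set
IsReduced [] = ⊤
IsReduced (a ∷ []) = ⊤
IsReduced (a ∷ b ∷ w) = ¬ Inverse a b × IsReduced (b ∷ w)

push : Letter → Word → Word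
push a [] = a ∷ []
push (i , a) ((j , b) ∷ w) with i ℕ.≟ j | a 𝔹.≟ not b
... | yes _ | yes _ = w
... | _     | _     = (i , a) ∷ (j , b) ∷ w

reduce : Word → Word
reduce = foldr push []

BeginsWith : Word → Word → Set
BeginsWith w p = ∃ λ r → w ≡ p ++ r

-- m ⊕ ε is m + 1 if ε = +1 (true) and m - 1 if ε = -1 (false)
_⊕_ : ℕ → Bool → ℕ
m ⊕ true = suc m
m ⊕ false = m ∸ 1

invWord : Word → Word
invWord = foldr (λ { (i , a) r → r ++ ((i , not a) ∷ []) }) []

σgen : ℕ → Bool → ℕ → Word
σgen k ε j with j ℕ.≟ k
... | yes _ = x (k ⊕ ε) ∷ x⁻¹ k ∷ x (k ⊕ not ε) ∷ []
... | no _  = x j ∷ []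

σletter : ℕ → Bool → Letter → Word
σletter k ε (j , true) = σgen k ε j
σletter k ε (j , false) = invWord (σgen k ε j)

act : Word → ℕ → Bool → Word
act f k ε = reduce (concatMap (σletter k ε) f)

-- The image of x_k under σ_k^ε is the block x_a x_k⁻¹ x_b with a = k ⊕ ε, b = k ⊕ ¬ε, that of
-- x_k⁻¹ is its inverse, and all other generators are fixed. When the concatenated image of a
-- reduced word f is freely reduced, cancellation never reaches the middle letter x_k^∓ of a
-- block: x_k^± x_k^∓ does not occur in f, and an outer letter of a block can only cancel
-- against a single fixed letter (x_b or x_a⁻¹), after which the next block starts. So the
-- first letters of (f)σ_k^ε are determined by the first two letters of f; this is the
-- invariant ImagePrefix, established by induction on f from the right.
module Submission where

open import Defs
open import Data.Nat using (ℕ; zero; suc; _≥_; _≤_; s≤s)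
open import Data.Nat.Properties using (1+n≢n; <⇒≢; >⇒≢; m<n⇒m<1+n; n<1+n)
open import Data.Bool using (Bool; true; false; not)
open import Data.List using ([]; _∷_; foldr)
open import Data.List.Properties using (foldr-++)
open import Data.Product using (_×_; _,_; proj₁; proj₂)
open import Data.Unit using (tt)
open import Data.Empty using (⊥-elim)
open import Function using (_∘_)
open import Relation.Binary.PropositionalEquality
  using (_≡_; _≢_; refl; sym; trans; cong; ≢-sym; module ≡-Reasoning)
open import Relation.Nullary using (¬_; Dec; yes; no)
open import Relation.Nullary.Decidable using (_×-dec_)
open import Data.Bool.Properties using (not-involutive)
import Data.Nat as ℕ
import Data.Bool as 𝔹

⊕-≢ : ∀ {k} ε → 1 ≤ k → k ⊕ ε ≢ k
⊕-≢ true  _       = 1+n≢n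
⊕-≢ false (s≤s _) = ≢-sym 1+n≢n

⊕-≢-⊕-not : ∀ {k} ε → 1 ≤ k → k ⊕ ε ≢ k ⊕ not ε
⊕-≢-⊕-not true  (s≤s {n = n} _) = >⇒≢ (m<n⇒m<1+n (n<1+n n))
⊕-≢-⊕-not false (s≤s {n = n} _) = <⇒≢ (m<n⇒m<1+n (n<1+n n))

k≡m⊕ε⇒m≡k⊕¬ε : ∀ {k m} ε → 1 ≤ k → k ≡ m ⊕ ε → m ≡ k ⊕ not ε
k≡m⊕ε⇒m≡k⊕¬ε             true  _  refl = refl
k≡m⊕ε⇒m≡k⊕¬ε {m = suc m} false _  refl = refl
k≡m⊕ε⇒m≡k⊕¬ε {m = zero}  false () refl

k⊕¬ε⊕ε≡k : ∀ {k} ε → 1 ≤ k → (k ⊕ not ε) ⊕ ε ≡ k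
k⊕¬ε⊕ε≡k true  (s≤s _) = refl
k⊕¬ε⊕ε≡k false _       = refl

inverse? : ∀ l h → Dec (Inverse l h)
inverse? (i , s) (j , t) = (i ℕ.≟ j) ×-dec (s 𝔹.≟ not t)

≢⇒¬Inverse : ∀ {i j s t} → i ≢ j → ¬ Inverse (i , s) (j , t)
≢⇒¬Inverse i≢j (i≡j , _) = i≢j i≡j

¬Inverse-sameSign : ∀ {i j} s → ¬ Inverse (i , s) (j , s)
¬Inverse-sameSign true  (_ , ())
¬Inverse-sameSign false (_ , ())

push-∷ : ∀ {l h t w} → w ≡ h ∷ t → ¬ Inverse l h → push l w ≡ l ∷ w
push-∷ {i , s} {j , t} refl ¬inv with i ℕ.≟ j | s 𝔹.≟ not t
... | yes i≡j | yes s≡¬t = ⊥-elim (¬inv (i≡j , s≡¬t))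
... | yes _   | no _     = refl
... | no _    | _        = refl

Inverse-sym : ∀ {l h} → Inverse l h → Inverse h l
Inverse-sym {_ , _} {_ , t} (refl , refl) = refl , sym (not-involutive t)

push-inverse : ∀ i s w → push (i , s) ((i , not s) ∷ w) ≡ w
push-inverse i s w with i ℕ.≟ i | s 𝔹.≟ not (not s)
... | yes _ | yes _   = refl
... | no i≢i | _      = ⊥-elim (i≢i refl)
... | yes _ | no s≢s  = ⊥-elim (s≢s (sym (not-involutive s)))

IsReduced-∷⁻ : ∀ {l} f → IsReduced (l ∷ f) → IsReduced f
IsReduced-∷⁻ []      _   = tt
IsReduced-∷⁻ (_ ∷ _) red = proj₂ red

module Image (k : ℕ) (ε : Bool) (1≤k : 1 ≤ k) where
  open ≡-Reasoning

  a b : ℕ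
  a = k ⊕ ε
  b = k ⊕ not ε

  a≢k : a ≢ k
  a≢k = ⊕-≢ ε 1≤k

  b≢k : b ≢ k
  b≢k = ⊕-≢ (not ε) 1≤k

  b≢a : b ≢ a
  b≢a = ≢-sym (⊕-≢-⊕-not ε 1≤k)

  b⊕ε≡k : b ⊕ ε ≡ k
  b⊕ε≡k = k⊕¬ε⊕ε≡k ε 1≤k

  A : Word → Word
  A f = act f k ε

  σgen-k : σgen k ε k ≡ x a ∷ x⁻¹ k ∷ x b ∷ []
  σgen-k with k ℕ.≟ k
  ... | yes _  = refl
  ... | no k≢k = ⊥-elim (k≢k refl)

  σgen-≢ : ∀ {j} → j ≢ k → σgen k ε j ≡ x j ∷ []
  σgen-≢ {j} j≢k with j ℕ.≟ k
  ... | yes j≡k = ⊥-elim (j≢k j≡k)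
  ... | no _    = refl

  A-∷ : ∀ l f → A (l ∷ f) ≡ foldr push (A f) (σletter k ε l)
  A-∷ l f = foldr-++ push [] (σletter k ε l) _

  A-xk∷-unfold : ∀ f → A (x k ∷ f) ≡ push (x a) (push (x⁻¹ k) (push (x b) (A f)))
  A-xk∷-unfold f = trans (A-∷ (x k) f) (cong (foldr push (A f)) σgen-k)

  A-xk⁻¹∷-unfold : ∀ f → A (x⁻¹ k ∷ f) ≡ push (x⁻¹ b) (push (x k) (push (x⁻¹ a) (A f)))
  A-xk⁻¹∷-unfold f =
    trans (A-∷ (x⁻¹ k) f) (cong (λ w → foldr push (A f) (invWord w)) σgen-k)

  A-fixed∷-unfold : ∀ {j s} f → j ≢ k → A ((j , s) ∷ f) ≡ push (j , s) (A f)
  A-fixed∷-unfold {j} {true}  f j≢k =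
    trans (A-∷ (x j) f) (cong (foldr push (A f)) (σgen-≢ j≢k))
  A-fixed∷-unfold {j} {false} f j≢k =
    trans (A-∷ (x⁻¹ j) f) (cong (λ w → foldr push (A f) (invWord w)) (σgen-≢ j≢k))

  data ImagePrefix : Word → Set where
    empty    : ImagePrefix []
    xk∷      : ∀ {f} → BeginsWith (A (x k ∷ f)) (x a ∷ x⁻¹ k ∷ []) → ImagePrefix (x k ∷ f)
    xk⁻¹∷    : ∀ {f} → BeginsWith (A (x⁻¹ k ∷ f)) (x⁻¹ b ∷ x k ∷ []) →
               ImagePrefix (x⁻¹ k ∷ f)
    xb∷xk⁻¹∷ : ∀ {f} → BeginsWith (A (x b ∷ x⁻¹ k ∷ f)) (x k ∷ []) →
               ImagePrefix (x b ∷ x⁻¹ k ∷ f)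
    xa⁻¹∷xk∷ : ∀ {f} → BeginsWith (A (x⁻¹ a ∷ x k ∷ f)) (x⁻¹ k ∷ []) →
               ImagePrefix (x⁻¹ a ∷ x k ∷ f)
    fixed∷   : ∀ {j s f} → j ≢ k → A ((j , s) ∷ f) ≡ (j , s) ∷ A f → ImagePrefix f →
               ImagePrefix ((j , s) ∷ f)

  fixed-by : ∀ {j s h t} f → j ≢ k → A f ≡ h ∷ t → ¬ Inverse (j , s) h → ImagePrefix f →
             ImagePrefix ((j , s) ∷ f)
  fixed-by f j≢k e ¬inv = fixed∷ j≢k (trans (A-fixed∷-unfold f j≢k) (push-∷ e ¬inv))

  push-xk⁻¹-A : ∀ {f} → ImagePrefix f → IsReduced (x⁻¹ b ∷ f) →
                BeginsWith (push (x⁻¹ k) (A f)) (x⁻¹ k ∷ [])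
  push-xk⁻¹-A empty               _   = [] , refl
  push-xk⁻¹-A (xk∷ (_ , e))       _   = _ , push-∷ e (≢⇒¬Inverse (≢-sym a≢k))
  push-xk⁻¹-A (xk⁻¹∷ (_ , e))     _   = _ , push-∷ e (¬Inverse-sameSign false)
  push-xk⁻¹-A (xb∷xk⁻¹∷ _)        red = ⊥-elim (proj₁ red (refl , refl))
  push-xk⁻¹-A (xa⁻¹∷xk∷ (_ , e))  _   = _ , push-∷ e (¬Inverse-sameSign false)
  push-xk⁻¹-A (fixed∷ j≢k e _)    _   = _ , push-∷ e (≢⇒¬Inverse (≢-sym j≢k))

  push-xk-A : ∀ {f} → ImagePrefix f → IsReduced (x a ∷ f) →
              BeginsWith (push (x k) (A f)) (x k ∷ [])
  push-xk-A empty               _   = [] , refl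
  push-xk-A (xk∷ (_ , e))       _   = _ , push-∷ e (¬Inverse-sameSign true)
  push-xk-A (xk⁻¹∷ (_ , e))     _   = _ , push-∷ e (≢⇒¬Inverse (≢-sym b≢k))
  push-xk-A (xb∷xk⁻¹∷ (_ , e))  _   = _ , push-∷ e (¬Inverse-sameSign true)
  push-xk-A (xa⁻¹∷xk∷ _)        red = ⊥-elim (proj₁ red (refl , refl))
  push-xk-A (fixed∷ j≢k e _)    _   = _ , push-∷ e (≢⇒¬Inverse (≢-sym j≢k))

  xb-kept : ∀ w → push (x b) w ≡ x b ∷ w →
            BeginsWith (push (x⁻¹ k) (push (x b) w)) (x⁻¹ k ∷ [])
  xb-kept _ e = _ , trans (cong (push (x⁻¹ k)) e) (push-∷ refl (≢⇒¬Inverse (≢-sym b≢k)))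

  middle-xk⁻¹-survives : ∀ {f} → ImagePrefix f → IsReduced (x k ∷ f) →
                         BeginsWith (push (x⁻¹ k) (push (x b) (A f))) (x⁻¹ k ∷ [])
  middle-xk⁻¹-survives empty              _   = xb-kept [] refl
  middle-xk⁻¹-survives (xk∷ (_ , e))      _   = xb-kept _ (push-∷ e (≢⇒¬Inverse b≢a))
  middle-xk⁻¹-survives (xk⁻¹∷ _)          red = ⊥-elim (proj₁ red (refl , refl))
  middle-xk⁻¹-survives (xb∷xk⁻¹∷ (_ , e)) _   = xb-kept _ (push-∷ e (≢⇒¬Inverse b≢k))
  middle-xk⁻¹-survives (xa⁻¹∷xk∷ (_ , e)) _   = xb-kept _ (push-∷ e (≢⇒¬Inverse b≢k))
  middle-xk⁻¹-survives (fixed∷ {j} {s} {f₀} _ e p) red with inverse? (j , s) (x b)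
  ... | yes (refl , refl) rewrite e | push-inverse b true (A f₀) = push-xk⁻¹-A p (proj₂ red)
  ... | no ¬inv = xb-kept _ (push-∷ e (¬inv ∘ Inverse-sym))

  xa⁻¹-kept : ∀ w → push (x⁻¹ a) w ≡ x⁻¹ a ∷ w →
              BeginsWith (push (x k) (push (x⁻¹ a) w)) (x k ∷ [])
  xa⁻¹-kept _ e = _ , trans (cong (push (x k)) e) (push-∷ refl (≢⇒¬Inverse (≢-sym a≢k)))

  middle-xk-survives : ∀ {f} → ImagePrefix f → IsReduced (x⁻¹ k ∷ f) →
                       BeginsWith (push (x k) (push (x⁻¹ a) (A f))) (x k ∷ [])
  middle-xk-survives empty              _   = xa⁻¹-kept [] refl
  middle-xk-survives (xk∷ _)            red = ⊥-elim (proj₁ red (refl , refl))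
  middle-xk-survives (xk⁻¹∷ (_ , e))    _   = xa⁻¹-kept _ (push-∷ e (≢⇒¬Inverse (≢-sym b≢a)))
  middle-xk-survives (xb∷xk⁻¹∷ (_ , e)) _   = xa⁻¹-kept _ (push-∷ e (≢⇒¬Inverse a≢k))
  middle-xk-survives (xa⁻¹∷xk∷ (_ , e)) _   = xa⁻¹-kept _ (push-∷ e (≢⇒¬Inverse a≢k))
  middle-xk-survives (fixed∷ {j} {s} {f₀} _ e p) red with inverse? (j , s) (x⁻¹ a)
  ... | yes (refl , refl) rewrite e | push-inverse a false (A f₀) = push-xk-A p (proj₂ red)
  ... | no ¬inv = xa⁻¹-kept _ (push-∷ e (¬inv ∘ Inverse-sym))

  A-xk∷ : ∀ {f} → ImagePrefix f → IsReduced (x k ∷ f) →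
          BeginsWith (A (x k ∷ f)) (x a ∷ x⁻¹ k ∷ [])
  A-xk∷ {f} p red with middle-xk⁻¹-survives p red
  ... | r , e = r , (begin
    A (x k ∷ f)                                         ≡⟨ A-xk∷-unfold f ⟩
    push (x a) (push (x⁻¹ k) (push (x b) (A f)))        ≡⟨ cong (push (x a)) e ⟩
    push (x a) (x⁻¹ k ∷ r)                              ≡⟨ push-∷ refl (≢⇒¬Inverse a≢k) ⟩
    x a ∷ x⁻¹ k ∷ r                                     ∎)

  A-xk⁻¹∷ : ∀ {f} → ImagePrefix f → IsReduced (x⁻¹ k ∷ f) →
            BeginsWith (A (x⁻¹ k ∷ f)) (x⁻¹ b ∷ x k ∷ [])
  A-xk⁻¹∷ {f} p red with middle-xk-survives p red
  ... | r , e = r , (begin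
    A (x⁻¹ k ∷ f)                                       ≡⟨ A-xk⁻¹∷-unfold f ⟩
    push (x⁻¹ b) (push (x k) (push (x⁻¹ a) (A f)))      ≡⟨ cong (push (x⁻¹ b)) e ⟩
    push (x⁻¹ b) (x k ∷ r)                              ≡⟨ push-∷ refl (≢⇒¬Inverse b≢k) ⟩
    x⁻¹ b ∷ x k ∷ r                                     ∎)

  A-xb∷xk⁻¹∷ : ∀ f → BeginsWith (A (x⁻¹ k ∷ f)) (x⁻¹ b ∷ x k ∷ []) →
               BeginsWith (A (x b ∷ x⁻¹ k ∷ f)) (x k ∷ [])
  A-xb∷xk⁻¹∷ f (r , e) = r , (begin
    A (x b ∷ x⁻¹ k ∷ f)               ≡⟨ A-fixed∷-unfold (x⁻¹ k ∷ f) b≢k ⟩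
    push (x b) (A (x⁻¹ k ∷ f))        ≡⟨ cong (push (x b)) e ⟩
    push (x b) (x⁻¹ b ∷ x k ∷ r)      ≡⟨ push-inverse b true _ ⟩
    x k ∷ r                           ∎)

  A-xa⁻¹∷xk∷ : ∀ f → BeginsWith (A (x k ∷ f)) (x a ∷ x⁻¹ k ∷ []) →
               BeginsWith (A (x⁻¹ a ∷ x k ∷ f)) (x⁻¹ k ∷ [])
  A-xa⁻¹∷xk∷ f (r , e) = r , (begin
    A (x⁻¹ a ∷ x k ∷ f)               ≡⟨ A-fixed∷-unfold (x k ∷ f) a≢k ⟩
    push (x⁻¹ a) (A (x k ∷ f))        ≡⟨ cong (push (x⁻¹ a)) e ⟩
    push (x⁻¹ a) (x a ∷ x⁻¹ k ∷ r)    ≡⟨ push-inverse a false _ ⟩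
    x⁻¹ k ∷ r                         ∎)

  prefix-fixed∷ : ∀ {j s f} → j ≢ k → IsReduced ((j , s) ∷ f) → ImagePrefix f →
                  ImagePrefix ((j , s) ∷ f)
  prefix-fixed∷ j≢k _ empty = fixed∷ j≢k (A-fixed∷-unfold [] j≢k) empty
  prefix-fixed∷ {j} {s} j≢k _ p@(xk∷ {f} (r , e)) with inverse? (j , s) (x a)
  ... | yes (refl , refl) = xa⁻¹∷xk∷ (A-xa⁻¹∷xk∷ f (r , e))
  ... | no ¬inv           = fixed-by (x k ∷ f) j≢k e ¬inv p
  prefix-fixed∷ {j} {s} j≢k _ p@(xk⁻¹∷ {f} (r , e)) with inverse? (j , s) (x⁻¹ b)
  ... | yes (refl , refl) = xb∷xk⁻¹∷ (A-xb∷xk⁻¹∷ f (r , e))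
  ... | no ¬inv           = fixed-by (x⁻¹ k ∷ f) j≢k e ¬inv p
  prefix-fixed∷ j≢k _ p@(xb∷xk⁻¹∷ {f} (_ , e)) =
    fixed-by (x b ∷ x⁻¹ k ∷ f) j≢k e (≢⇒¬Inverse j≢k) p
  prefix-fixed∷ j≢k _ p@(xa⁻¹∷xk∷ {f} (_ , e)) =
    fixed-by (x⁻¹ a ∷ x k ∷ f) j≢k e (≢⇒¬Inverse j≢k) p
  prefix-fixed∷ j≢k red p@(fixed∷ {j′} {s′} {f} _ e _) =
    fixed-by ((j′ , s′) ∷ f) j≢k e (proj₁ red) p

  prefix-∷ : ∀ l {f} → IsReduced (l ∷ f) → ImagePrefix f → ImagePrefix (l ∷ f)
  prefix-∷ (j , s) red p with j ℕ.≟ k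
  prefix-∷ (j , true)  red p | yes refl = xk∷ (A-xk∷ p red)
  prefix-∷ (j , false) red p | yes refl = xk⁻¹∷ (A-xk⁻¹∷ p red)
  prefix-∷ (j , s)     red p | no j≢k   = prefix-fixed∷ j≢k red p

  imagePrefix : ∀ f → IsReduced f → ImagePrefix f
  imagePrefix []      _   = empty
  imagePrefix (l ∷ f) red = prefix-∷ l red (imagePrefix f (IsReduced-∷⁻ f red))

  head-shifts : ∀ {j f} → IsReduced (x j ∷ f) → k ≡ j ⊕ ε →
                BeginsWith (x j ∷ f) (x j ∷ x⁻¹ (j ⊕ ε) ∷ []) →
                BeginsWith (A (x j ∷ f)) (x (j ⊕ ε) ∷ [])
  head-shifts _ k≡j⊕ε _ with k≡m⊕ε⇒m≡k⊕¬ε ε 1≤k k≡j⊕ε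
  head-shifts red _ (f , refl) | refl rewrite b⊕ε≡k =
    A-xb∷xk⁻¹∷ f (A-xk⁻¹∷ (imagePrefix f (IsReduced-∷⁻ f (proj₂ red))) (proj₂ red))

  head-expands : ∀ {j f} → IsReduced (x j ∷ f) → k ≡ j →
                 BeginsWith (A (x j ∷ f)) (x (j ⊕ ε) ∷ x⁻¹ j ∷ [])
  head-expands {f = f} red refl = A-xk∷ (imagePrefix f (IsReduced-∷⁻ f red)) red

  head-kept : ∀ {j f} → IsReduced (x j ∷ f) →
              ¬ (k ≡ j ⊕ ε × BeginsWith (x j ∷ f) (x j ∷ x⁻¹ (j ⊕ ε) ∷ [])) → k ≢ j →
              BeginsWith (A (x j ∷ f)) (x j ∷ [])
  head-kept {j} {f} red ¬shift k≢j with imagePrefix (x j ∷ f) red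
  ... | xk∷ _              = ⊥-elim (k≢j refl)
  ... | xb∷xk⁻¹∷ {f₀} _    =
    ⊥-elim (¬shift (sym b⊕ε≡k , f₀ , cong (λ n → x b ∷ x⁻¹ n ∷ f₀) (sym b⊕ε≡k)))
  ... | fixed∷ _ e _       = A f , e

mainTheorem2 : (f : Word) (m k : ℕ) (ε : Bool) →
    IsReduced f → BeginsWith f (x m ∷ []) → k ≥ 1 →
    ((k ≡ m ⊕ ε → BeginsWith f (x m ∷ x⁻¹ (m ⊕ ε) ∷ []) →
        BeginsWith (act f k ε) (x (m ⊕ ε) ∷ []))
    × (k ≡ m → BeginsWith (act f k ε) (x (m ⊕ ε) ∷ x⁻¹ m ∷ []))
    × (¬ (k ≡ m ⊕ ε × BeginsWith f (x m ∷ x⁻¹ (m ⊕ ε) ∷ [])) → k ≢ m →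
        BeginsWith (act f k ε) (x m ∷ [])))
mainTheorem2 .(x m ∷ r) m k ε red (r , refl) 1≤k =
  head-shifts red , head-expands red , head-kept red
  where open Image k ε 1≤k
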